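{- Let $k\in\mathbb{Z}$ with $k\equiv \pm3 \pmod{12}$. Then $\operatorname{Ker}\nu_{\eta^{2k}}$ is the set of $\begin{pmatrix} a&b\\ c&d\end{pmatrix}\in\Gamma(1)$ congruent modulo $4$ to one of $$\begin{pmatrix} 1&0\\ 0&1\end{pmatrix},\begin{pmatrix} 1&2\\ 2&1\end{pmatrix},\begin{pmatrix} -1&0\\ 2&-1\end{pmatrix},\begin{pmatrix} -1&2\\ 0&-1\end{pmatrix},\begin{pmatrix} 2&1\\ 1&1\end{pmatrix},\begin{pmatrix} 2&-1\\ -1&1\end{pmatrix},\begin{pmatrix} 0&1\\ -1&-1\end{pmatrix},\begin{pmatrix} 0&-1\\ 1&-1\end{pmatrix},$$ $$\begin{pmatrix} 1&1\\ 1&2\end{pmatrix},\begin{pmatrix} 1&-1\\ -1&2\end{pmatrix},\begin{pmatrix} -1&1\\ -1&0\end{pmatrix},\begin{pmatrix} -1&-1\\ 1&0\end{pmatrix}.$$ Moreover, the matrices $S^n$ $(0\le n\le 3)$, where $S=\begin{pmatrix} 1&1\\ 0&1\end{pmatrix}$, form a complete set of coset representatives of $\Gamma(1)$ modulo $\operatorname{Ker}\nu_{\eta^{2k}}$.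
   Context: Let $\Gamma(1)=SL(2,\mathbb{Z})$, acting on the upper half plane $\mathscr{H}=\{\tau\in\mathbb{C}:\Im\tau>0\}$ by $M\tau=\frac{a\tau+b}{c\tau+d}$ for $M=\begin{pmatrix} a&b\\ c&d\end{pmatrix}$. Let $\eta(\tau)=q^{1/24}\prod_{n\ge1}(1-q^n)$ with $q=e^{2\pi i\tau}$ and $q^{1/24}=e^{2\pi i\tau/24}$. For $m\in\mathbb{Z}$, the multiplier system $\nu_{\eta^{2m}}:\Gamma(1)\to\mathbb{C}^\times$ is defined by $\eta^{2m}(M\tau)=\nu_{\eta^{2m}}(M)(c\tau+d)^m\eta^{2m}(\tau)$ for all $\tau\in\mathscr{H}$; it is a character of $\Gamma(1)$, given explicitly by $\nu_{\eta^{2m}}(M)=\exp\{\frac{m\pi i}{6}f(M)\}$, where $f(M)=(a+d)c-bd(c^2-1)-3c$ if $c$ is odd and $f(M)=(a+d)c-bd(c^2-1)+3d-3-3cd$ if $c$ is even. $\operatorname{Ker}\nu_{\eta^{2m}}$ denotes its kernel. Congruences between integer matrices are entrywise. -}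

module Defs where

open import Data.Integer using (ℤ; +_; -_; _+_; _-_; _*_)
open import Data.Integer.Divisibility using (_∣_)
open import Data.Integer.DivMod using (_%ℕ_)
open import Data.Nat using (ℕ; zero; suc)
open import Data.List using (List; []; _∷_)
open import Data.List.Relation.Unary.Any using (Any)
open import Data.Product using (_×_)
open import Relation.Binary.PropositionalEquality using (_≡_)

record Mat2 : Set where
  constructor mat
  field
    a b c d : ℤ
open Mat2 public

det : Mat2 → ℤ
det M = a M * d M - b M * c M

InΓ1 : Mat2 → Set
InΓ1 M = det M ≡ + 1

_·_ : Mat2 → Mat2 → Mat2
M · N = mat (a M * a N + b M * c N) (a M * b N + b M * d N)
            (c M * a N + d M * c N) (c M * b N + d M * d N)

I₂ : Mat2
I₂ = mat (+ 1) (+ 0) (+ 0) (+ 1)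

_^_ : Mat2 → ℕ → Mat2
M ^ zero = I₂
M ^ suc n = M · (M ^ n)

-- inverse of a determinant-1 matrix
inv : Mat2 → Mat2
inv M = mat (d M) (- b M) (- c M) (a M)

S : Mat2
S = mat (+ 1) (+ 1) (+ 0) (+ 1)

f : Mat2 → ℤ
f M with c M %ℕ 2
... | zero  = (a M + d M) * c M - b M * d M * (c M * c M - + 1)
                + + 3 * d M - + 3 - + 3 * c M * d M
... | suc _ = (a M + d M) * c M - b M * d M * (c M * c M - + 1) - + 3 * c M

-- ν_{η^{2m}}(M) = exp(mπi f(M)/6) = ζ₁₂^{m f(M)} with ζ₁₂ = e^{2πi/12}.
-- We represent this 12th root of unity by its exponent νExp m M ∈ ℤ
-- (meaningful modulo 12); ν(M) = 1 iff 12 ∣ νExp m M.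
νExp : ℤ → Mat2 → ℤ
νExp m M = m * f M

InKer : ℤ → Mat2 → Set
InKer m M = InΓ1 M × (+ 12 ∣ νExp m M)

_≡_[mod_] : ℤ → ℤ → ℤ → Set
x ≡ y [mod n ] = n ∣ (x - y)

_≡ₘ_[mod_] : Mat2 → Mat2 → ℤ → Set
M ≡ₘ N [mod n ] =
  (a M ≡ a N [mod n ]) × (b M ≡ b N [mod n ]) ×
  (c M ≡ c N [mod n ]) × (d M ≡ d N [mod n ])

private
  m : ℤ → ℤ → ℤ → ℤ → Mat2
  m = mat
  -1ℤ : ℤ
  -1ℤ = - + 1

kerReps : List Mat2
kerReps =
    m (+ 1) (+ 0) (+ 0) (+ 1)
  ∷ m (+ 1) (+ 2) (+ 2) (+ 1)
  ∷ m -1ℤ (+ 0) (+ 2) -1ℤ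
  ∷ m -1ℤ (+ 2) (+ 0) -1ℤ
  ∷ m (+ 2) (+ 1) (+ 1) (+ 1)
  ∷ m (+ 2) -1ℤ -1ℤ (+ 1)
  ∷ m (+ 0) (+ 1) -1ℤ -1ℤ
  ∷ m (+ 0) -1ℤ (+ 1) -1ℤ
  ∷ m (+ 1) (+ 1) (+ 1) (+ 2)
  ∷ m (+ 1) -1ℤ -1ℤ (+ 2)
  ∷ m -1ℤ (+ 1) -1ℤ (+ 0)
  ∷ m -1ℤ -1ℤ (+ 1) (+ 0)
  ∷ []

{-# OPTIONS --safe #-}
-- Since k ≡ ±3 (mod 12), k f(M) ≡ ±3 f(M) (mod 12), so ν(M) = ζ₁₂^{k f(M)} is 1 exactly
-- when 4 ∣ f(M).  For even n, f(M) mod n depends only on M mod n (the branch taken by f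
-- depends only on c mod 2), so the kernel and the cosets of S⁰, …, S³ are described by
-- properties of M mod 4; these hold for all M once they hold for the 4⁴ residue
-- matrices, where they are decided by evaluation.
module Submission where

open import Defs
open import Data.Integer as ℤ using (ℤ; +_; -_; _+_; _-_; _*_; ∣_∣)
open import Data.Integer.Divisibility using (_∣_; *-cancelˡ-∣; *-monoʳ-∣)
open import Data.Integer.Divisibility.Signed as Signed
  using (divides; ∣ᵤ⇒∣; ∣⇒∣ᵤ) renaming (_∣_ to _∣ˢ_)
open import Data.Integer.DivMod using (_%ℕ_; _/ℕ_; a≡a%ℕn+[a/ℕn]*n; n%ℕd<d)
open import Data.Integer.Properties
  using (+-injective; ∣i∣≡0⇒i≡0; i-j≡0⇒i≡j; [+m]-[+n]≡m⊖n; ∣m⊝n∣≤m⊔n)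
open import Data.Integer.Tactic.RingSolver using (solve-∀)
open import Data.Nat as ℕ using (ℕ; zero; suc; NonZero)
import Data.Nat.Divisibility as ℕ using (_∣?_; n∣m⇒m%n≡0)
open import Data.Nat.DivMod using (m<n⇒m%n≡m)
open import Data.Nat.Properties using (≤-<-trans; ⊔-pres-<m)
open import Data.Fin as Fin using (Fin; toℕ; fromℕ<)
open import Data.Fin.Properties using (toℕ-fromℕ<; all?; any?)
open import Data.List.Relation.Unary.All as All using (All)
open import Data.List.Relation.Unary.Any as Any using (Any)
open import Relation.Nullary.Decidable as Dec using (Dec; _×-dec_; _→-dec_; toWitness)
open import Data.Product using (_×_; ∃; _,_; proj₂; map₂)
open import Data.Sum using (_⊎_; inj₁; inj₂)
open import Function.Base using (_∘_)
open import Function.Bundles using (_⇔_; mk⇔; Equivalence)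
open Equivalence using (to; from)
open import Function.Construct.Composition using (_⇔-∘_)
open import Relation.Binary.PropositionalEquality
  using (module ≡-Reasoning; _≡_; refl; sym; trans; cong; cong₂; subst)
open ≡-Reasoning

-- Unlike x ≡ y [mod n ], the record determines x, y and n, so the combinators below can
-- be applied to proofs shaped like the polynomial expressions they relate.
infix 4 _≋_[mod_]
record _≋_[mod_] (x y n : ℤ) : Set where
  constructor wrap
  field unwrap : n ∣ˢ x - y

module _ {n : ℤ} where

  ≋-reflexive : ∀ {x y} → x ≡ y → x ≋ y [mod n ]
  ≋-reflexive {x} refl = wrap (divides (+ 0) (x-x≡0*n x))
    where
    x-x≡0*n : ∀ x → x - x ≡ + 0 * n
    x-x≡0*n = solve-∀

  ≋-refl : ∀ {x} → x ≋ x [mod n ]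
  ≋-refl = ≋-reflexive refl

  ≋-sym : ∀ {x y} → x ≋ y [mod n ] → y ≋ x [mod n ]
  ≋-sym {x} {y} (wrap n∣x-y) = wrap (subst (n ∣ˢ_) (swap x y) (Signed.∣m⇒∣-m n∣x-y))
    where
    swap : ∀ x y → - (x - y) ≡ y - x
    swap = solve-∀

  ≋-trans : ∀ {x y z} → x ≋ y [mod n ] → y ≋ z [mod n ] → x ≋ z [mod n ]
  ≋-trans {x} {y} {z} (wrap n∣x-y) (wrap n∣y-z) =
    wrap (subst (n ∣ˢ_) (telescope x y z) (Signed.∣m∣n⇒∣m+n n∣x-y n∣y-z))
    where
    telescope : ∀ x y z → (x - y) + (y - z) ≡ x - z
    telescope = solve-∀

  infixl 6 _+≋_ _-≋_
  infixl 7 _*≋_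
  infix 8 -≋_

  _+≋_ : ∀ {x y u v} → x ≋ y [mod n ] → u ≋ v [mod n ] → x + u ≋ y + v [mod n ]
  _+≋_ {x} {y} {u} {v} (wrap n∣x-y) (wrap n∣u-v) =
    wrap (subst (n ∣ˢ_) (regroup x y u v) (Signed.∣m∣n⇒∣m+n n∣x-y n∣u-v))
    where
    regroup : ∀ x y u v → (x - y) + (u - v) ≡ (x + u) - (y + v)
    regroup = solve-∀

  -≋_ : ∀ {x y} → x ≋ y [mod n ] → - x ≋ - y [mod n ]
  -≋_ {x} {y} (wrap n∣x-y) = wrap (subst (n ∣ˢ_) (negate x y) (Signed.∣m⇒∣-m n∣x-y))
    where
    negate : ∀ x y → - (x - y) ≡ - x - - y
    negate = solve-∀

  _-≋_ : ∀ {x y u v} → x ≋ y [mod n ] → u ≋ v [mod n ] → x - u ≋ y - v [mod n ]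
  x≋y -≋ u≋v = x≋y +≋ -≋ u≋v

  _*≋_ : ∀ {x y u v} → x ≋ y [mod n ] → u ≋ v [mod n ] → x * u ≋ y * v [mod n ]
  _*≋_ {x} {y} {u} {v} (wrap n∣x-y) (wrap n∣u-v) =
    wrap (subst (n ∣ˢ_) (expand x y u v)
      (Signed.∣m∣n⇒∣m+n (Signed.∣n⇒∣m*n x n∣u-v) (Signed.∣m⇒∣m*n v n∣x-y)))
    where
    expand : ∀ x y u v → x * (u - v) + (x - y) * v ≡ x * u - y * v
    expand = solve-∀

≋-weaken : ∀ {m n x y} → m ∣ˢ n → x ≋ y [mod n ] → x ≋ y [mod m ]
≋-weaken m∣n (wrap n∣x-y) = wrap (Signed.∣-trans m∣n n∣x-y)

≡-mod⇒≋ : ∀ {x y n} → x ≡ y [mod n ] → x ≋ y [mod n ]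
≡-mod⇒≋ x≡y = wrap (∣ᵤ⇒∣ x≡y)

≋⇒≡-mod : ∀ {x y n} → x ≋ y [mod n ] → x ≡ y [mod n ]
≋⇒≡-mod (wrap n∣x-y) = ∣⇒∣ᵤ n∣x-y

∣-resp-≋ : ∀ {x y n} → x ≋ y [mod n ] → n ∣ x → n ∣ y
∣-resp-≋ {x} {y} {n} (wrap n∣x-y) n∣x =
  ∣⇒∣ᵤ (subst (n ∣ˢ_) (cancel x y) (Signed.∣m∣n⇒∣m-n (∣ᵤ⇒∣ {n} {x} n∣x) n∣x-y))
  where
  cancel : ∀ x y → x - (x - y) ≡ y
  cancel = solve-∀

scaled-∣⇔ : ∀ u n k z .{{_ : ℤ.NonZero u}} → k ≡ u [mod u * n ] → ((u * n) ∣ (k * z)) ⇔ (n ∣ z)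
scaled-∣⇔ u n k z k≡u =
  mk⇔ (*-cancelˡ-∣ u ∘ ∣-resp-≋ k*z≋u*z) (∣-resp-≋ (≋-sym k*z≋u*z) ∘ *-monoʳ-∣ u)
  where
  k*z≋u*z : k * z ≋ u * z [mod u * n ]
  k*z≋u*z = ≡-mod⇒≋ {k} {u} k≡u *≋ ≋-refl {x = z}

12∣k*z⇔4∣z : ∀ k → k ≡ + 3 [mod + 12 ] ⊎ k ≡ - + 3 [mod + 12 ] → ∀ z → (+ 12 ∣ k * z) ⇔ (+ 4 ∣ z)
12∣k*z⇔4∣z k (inj₁ k≡3)  z = scaled-∣⇔ (+ 3) (+ 4) k z k≡3
12∣k*z⇔4∣z k (inj₂ k≡-3) z = scaled-∣⇔ (- + 3) (+ 4) k z k≡-3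

InKer⇔ : ∀ k → k ≡ + 3 [mod + 12 ] ⊎ k ≡ - + 3 [mod + 12 ] →
         ∀ M → InKer k M ⇔ (InΓ1 M × + 4 ∣ f M)
InKer⇔ k k≡±3 M = mk⇔ (map₂ (to 12∣kf⇔4∣f)) (map₂ (from 12∣kf⇔4∣f))
  where
  12∣kf⇔4∣f : (+ 12 ∣ k * f M) ⇔ (+ 4 ∣ f M)
  12∣kf⇔4∣f = 12∣k*z⇔4∣z k k≡±3 (f M)

module _ (m : ℕ) .{{_ : NonZero m}} where

  ≋-%ℕ : ∀ x → x ≋ + (x %ℕ m) [mod + m ]
  ≋-%ℕ x = wrap (divides q (begin
    x - + r               ≡⟨ cong (_- + r) (a≡a%ℕn+[a/ℕn]*n x m) ⟩
    (+ r + q * + m) - + r ≡⟨ cancel (+ r) q (+ m) ⟩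
    q * + m               ∎))
    where
    r : ℕ
    r = x %ℕ m
    q : ℤ
    q = x /ℕ m
    cancel : ∀ r q m → (r + q * m) - r ≡ q * m
    cancel = solve-∀

  remainder-unique : ∀ {r s} → r ℕ.< m → s ℕ.< m → + r ≋ + s [mod + m ] → r ≡ s
  remainder-unique {r} {s} r<m s<m (wrap m∣r-s) =
    +-injective (i-j≡0⇒i≡j (+ r) (+ s) (∣i∣≡0⇒i≡0 ∣r-s∣≡0))
    where
    ∣r-s∣<m : ∣ + r - + s ∣ ℕ.< m
    ∣r-s∣<m = ≤-<-trans
      (subst (ℕ._≤ r ℕ.⊔ s) (cong ∣_∣ (sym ([+m]-[+n]≡m⊖n r s))) (∣m⊝n∣≤m⊔n r s))
      (⊔-pres-<m r<m s<m)
    ∣r-s∣≡0 : ∣ + r - + s ∣ ≡ 0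
    ∣r-s∣≡0 = trans (sym (m<n⇒m%n≡m ∣r-s∣<m)) (ℕ.n∣m⇒m%n≡0 _ m (∣⇒∣ᵤ m∣r-s))

  %ℕ-cong : ∀ {x y} → x ≋ y [mod + m ] → x %ℕ m ≡ y %ℕ m
  %ℕ-cong {x} {y} x≋y = remainder-unique (n%ℕd<d x m) (n%ℕd<d y m)
    (≋-trans (≋-sym (≋-%ℕ x)) (≋-trans x≋y (≋-%ℕ y)))

infix 4 _≋ₘ_[mod_]
record _≋ₘ_[mod_] (M N : Mat2) (n : ℤ) : Set where
  constructor entrywise
  field
    a≋ : a M ≋ a N [mod n ]
    b≋ : b M ≋ b N [mod n ]
    c≋ : c M ≋ c N [mod n ]
    d≋ : d M ≋ d N [mod n ]
open _≋ₘ_[mod_]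

module _ {n : ℤ} where

  ≋ₘ-refl : ∀ {M} → M ≋ₘ M [mod n ]
  ≋ₘ-refl = entrywise ≋-refl ≋-refl ≋-refl ≋-refl

  ≋ₘ-sym : ∀ {M N} → M ≋ₘ N [mod n ] → N ≋ₘ M [mod n ]
  ≋ₘ-sym (entrywise p q r s) = entrywise (≋-sym p) (≋-sym q) (≋-sym r) (≋-sym s)

  ≋ₘ-trans : ∀ {M N P} → M ≋ₘ N [mod n ] → N ≋ₘ P [mod n ] → M ≋ₘ P [mod n ]
  ≋ₘ-trans (entrywise p q r s) (entrywise p′ q′ r′ s′) =
    entrywise (≋-trans p p′) (≋-trans q q′) (≋-trans r r′) (≋-trans s s′)

  ≡ₘ⇒≋ₘ : ∀ {M N} → M ≡ₘ N [mod n ] → M ≋ₘ N [mod n ]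
  ≡ₘ⇒≋ₘ (p , q , r , s) = entrywise (≡-mod⇒≋ p) (≡-mod⇒≋ q) (≡-mod⇒≋ r) (≡-mod⇒≋ s)

  ≋ₘ⇒≡ₘ : ∀ {M N} → M ≋ₘ N [mod n ] → M ≡ₘ N [mod n ]
  ≋ₘ⇒≡ₘ (entrywise p q r s) = ≋⇒≡-mod p , ≋⇒≡-mod q , ≋⇒≡-mod r , ≋⇒≡-mod s

  ·-cong : ∀ {M M′ N N′} → M ≋ₘ M′ [mod n ] → N ≋ₘ N′ [mod n ] → M · N ≋ₘ M′ · N′ [mod n ]
  ·-cong (entrywise p q r s) (entrywise p′ q′ r′ s′) = entrywise
    (p *≋ p′ +≋ q *≋ r′) (p *≋ q′ +≋ q *≋ s′)
    (r *≋ p′ +≋ s *≋ r′) (r *≋ q′ +≋ s *≋ s′)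

  det-cong : ∀ {M N} → M ≋ₘ N [mod n ] → det M ≋ det N [mod n ]
  det-cong (entrywise p q r s) = p *≋ s -≋ q *≋ r

fByParity : ℕ → Mat2 → ℤ
fByParity zero    M = (a M + d M) * c M - b M * d M * (c M * c M - + 1)
                        + + 3 * d M - + 3 - + 3 * c M * d M
fByParity (suc _) M = (a M + d M) * c M - b M * d M * (c M * c M - + 1) - + 3 * c M

f≡fByParity : ∀ M → f M ≡ fByParity (c M %ℕ 2) M
f≡fByParity M with c M %ℕ 2
... | zero  = refl
... | suc _ = refl

fByParity-cong : ∀ {n M N} r → M ≋ₘ N [mod n ] → fByParity r M ≋ fByParity r N [mod n ]
fByParity-cong {n} zero (entrywise p q r s) =
  (p +≋ s) *≋ r -≋ q *≋ s *≋ (r *≋ r -≋ ≋-refl) +≋ three *≋ s -≋ three -≋ three *≋ r *≋ s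
  where
  three : + 3 ≋ + 3 [mod n ]
  three = ≋-refl
fByParity-cong {n} (suc _) (entrywise p q r s) =
  (p +≋ s) *≋ r -≋ q *≋ s *≋ (r *≋ r -≋ ≋-refl) -≋ three *≋ r
  where
  three : + 3 ≋ + 3 [mod n ]
  three = ≋-refl

f-cong : ∀ {n M N} → + 2 ∣ˢ n → M ≋ₘ N [mod n ] → f M ≋ f N [mod n ]
f-cong {n} {M} {N} 2∣n M≋N
  rewrite f≡fByParity M | f≡fByParity N | %ℕ-cong 2 (≋-weaken 2∣n (c≋ M≋N))
  = fByParity-cong (c N %ℕ 2) M≋N

det-· : ∀ M N → det (M · N) ≡ det M * det N
det-· (mat a₁ b₁ c₁ d₁) (mat a₂ b₂ c₂ d₂) = binet a₁ b₁ c₁ d₁ a₂ b₂ c₂ d₂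
  where
  binet : ∀ a₁ b₁ c₁ d₁ a₂ b₂ c₂ d₂ →
    (a₁ * a₂ + b₁ * c₂) * (c₁ * b₂ + d₁ * d₂) - (a₁ * b₂ + b₁ * d₂) * (c₁ * a₂ + d₁ * c₂)
      ≡ (a₁ * d₁ - b₁ * c₁) * (a₂ * d₂ - b₂ * c₂)
  binet = solve-∀

InΓ1-· : ∀ M N → InΓ1 M → InΓ1 N → InΓ1 (M · N)
InΓ1-· M N detM≡1 detN≡1 = begin
  det (M · N)     ≡⟨ det-· M N ⟩
  det M * det N   ≡⟨ cong₂ _*_ detM≡1 detN≡1 ⟩
  + 1             ∎

InΓ1-inv : ∀ M → InΓ1 M → InΓ1 (inv M)
InΓ1-inv (mat a b c d) = trans (det-inv a b c d)
  where
  det-inv : ∀ a b c d → d * a - (- b) * (- c) ≡ a * d - b * c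
  det-inv = solve-∀

InΓ1-S^ : ∀ n → InΓ1 (S ^ n)
InΓ1-S^ zero    = refl
InΓ1-S^ (suc n) = InΓ1-· S (S ^ n) refl (InΓ1-S^ n)

module _ (m : ℕ) .{{_ : NonZero m}} where

  residue : ℤ → Fin m
  residue x = fromℕ< (n%ℕd<d x m)

  ≋-residue : ∀ x → x ≋ + toℕ (residue x) [mod + m ]
  ≋-residue x = subst (λ r → x ≋ + r [mod + m ]) (sym (toℕ-fromℕ< (n%ℕd<d x m))) (≋-%ℕ m x)

  residueMat : Fin m → Fin m → Fin m → Fin m → Mat2
  residueMat i j k l = mat (+ toℕ i) (+ toℕ j) (+ toℕ k) (+ toℕ l)

  reduce : Mat2 → Mat2
  reduce M = residueMat (residue (a M)) (residue (b M)) (residue (c M)) (residue (d M))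

  ≋ₘ-reduce : ∀ M → M ≋ₘ reduce M [mod + m ]
  ≋ₘ-reduce M = entrywise (≋-residue (a M)) (≋-residue (b M)) (≋-residue (c M)) (≋-residue (d M))

  residue-induction : (P : Mat2 → Set) → (∀ {M N} → M ≋ₘ N [mod + m ] → P N → P M) →
                      (∀ i j k l → P (residueMat i j k l)) → ∀ M → P M
  residue-induction P resp P-residues M = resp (≋ₘ-reduce M) (P-residues _ _ _ _)

infix 4 _∣?_ _≡?_[mod_] _≋?_[mod_] _≡ₘ?_[mod_]

_∣?_ : ∀ n x → Dec (n ∣ x)
n ∣? x = ∣ n ∣ ℕ.∣? ∣ x ∣

_≡?_[mod_] : ∀ x y n → Dec (x ≡ y [mod n ])
x ≡? y [mod n ] = n ∣? x - y

_≋?_[mod_] : ∀ x y n → Dec (x ≋ y [mod n ])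
x ≋? y [mod n ] = Dec.map′ ≡-mod⇒≋ ≋⇒≡-mod (x ≡? y [mod n ])

_≡ₘ?_[mod_] : ∀ M N n → Dec (M ≡ₘ N [mod n ])
M ≡ₘ? N [mod n ] = a M ≡? a N [mod n ] ×-dec b M ≡? b N [mod n ]
             ×-dec c M ≡? c N [mod n ] ×-dec d M ≡? d N [mod n ]

KernelResidue : Mat2 → Set
KernelResidue M = det M ≋ + 1 [mod + 4 ] → + 4 ∣ f M → Any (λ R → M ≡ₘ R [mod + 4 ]) kerReps

CosetResidue : Mat2 → Set
CosetResidue M = det M ≋ + 1 [mod + 4 ] → ∃ λ (n : Fin 4) → + 4 ∣ f (inv (S ^ toℕ n) · M)

kernelResidue-residues : ∀ i j k l → KernelResidue (residueMat 4 i j k l)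
kernelResidue-residues = toWitness {a? = all? λ i → all? λ j → all? λ k → all? λ l →
  let R = residueMat 4 i j k l in
  det R ≋? + 1 [mod + 4 ] →-dec + 4 ∣? f R →-dec Any.any? (R ≡ₘ?_[mod + 4 ]) kerReps} _

cosetResidue-residues : ∀ i j k l → CosetResidue (residueMat 4 i j k l)
cosetResidue-residues = toWitness {a? = all? λ i → all? λ j → all? λ k → all? λ l →
  let R = residueMat 4 i j k l in
  det R ≋? + 1 [mod + 4 ] →-dec any? λ n → + 4 ∣? f (inv (S ^ toℕ n) · R)} _

kerReps-4∣f : All (λ R → + 4 ∣ f R) kerReps
kerReps-4∣f = toWitness {a? = All.all? (λ R → + 4 ∣? f R) kerReps} _

S^-cosets-distinct : ∀ n n′ → + 4 ∣ f (inv (S ^ toℕ n) · (S ^ toℕ n′)) → n ≡ n′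
S^-cosets-distinct = toWitness {a? = all? λ (n : Fin 4) → all? λ n′ →
  + 4 ∣? f (inv (S ^ toℕ n) · (S ^ toℕ n′)) →-dec n Fin.≟ n′} _

2∣4 : + 2 ∣ˢ + 4
2∣4 = divides (+ 2) refl

kernelResidue-resp : ∀ {M N} → M ≋ₘ N [mod + 4 ] → KernelResidue N → KernelResidue M
kernelResidue-resp {M} {N} M≋N kerN detM≋1 4∣fM =
  Any.map (λ {R} N≡R → ≋ₘ⇒≡ₘ (≋ₘ-trans M≋N (≡ₘ⇒≋ₘ {M = N} {N = R} N≡R)))
    (kerN (≋-trans (≋-sym (det-cong M≋N)) detM≋1) (∣-resp-≋ (f-cong 2∣4 M≋N) 4∣fM))

cosetResidue-resp : ∀ {M N} → M ≋ₘ N [mod + 4 ] → CosetResidue N → CosetResidue M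
cosetResidue-resp M≋N cosetN detM≋1 =
  map₂ (λ {n} → ∣-resp-≋ (f-cong 2∣4 (·-cong (≋ₘ-refl {M = inv (S ^ toℕ n)}) (≋ₘ-sym M≋N))))
    (cosetN (≋-trans (≋-sym (det-cong M≋N)) detM≋1))

kernelResidue : ∀ M → KernelResidue M
kernelResidue = residue-induction 4 KernelResidue kernelResidue-resp kernelResidue-residues

cosetResidue : ∀ M → CosetResidue M
cosetResidue = residue-induction 4 CosetResidue cosetResidue-resp cosetResidue-residues

kernel-mod-4 : ∀ M → (InΓ1 M × + 4 ∣ f M) ⇔ (InΓ1 M × Any (λ R → M ≡ₘ R [mod + 4 ]) kerReps)
kernel-mod-4 M = mk⇔
  (λ (detM≡1 , 4∣fM) → detM≡1 , kernelResidue M (≋-reflexive detM≡1) 4∣fM)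
  (λ (detM≡1 , M≡R) → detM≡1 , All.lookupWith 4∣f-from-rep kerReps-4∣f M≡R)
  where
  4∣f-from-rep : ∀ {R} → + 4 ∣ f R → M ≡ₘ R [mod + 4 ] → + 4 ∣ f M
  4∣f-from-rep {R} 4∣fR M≡R = ∣-resp-≋ (f-cong 2∣4 (≋ₘ-sym (≡ₘ⇒≋ₘ {M = M} {N = R} M≡R))) 4∣fR

coset-representative : ∀ {M} → InΓ1 M →
  ∃ λ (n : Fin 4) → InΓ1 (inv (S ^ toℕ n) · M) × + 4 ∣ f (inv (S ^ toℕ n) · M)
coset-representative {M} detM≡1 =
  map₂ (λ {n} → InΓ1-· (inv (S ^ toℕ n)) M (InΓ1-inv (S ^ toℕ n) (InΓ1-S^ (toℕ n))) detM≡1 ,_)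
    (cosetResidue M (≋-reflexive detM≡1))

mainTheorem4 : (k : ℤ) → (+ 12 ∣ (k - + 3)) ⊎ (+ 12 ∣ (k + + 3)) →
    ((M : Mat2) → InKer k M ⇔ (InΓ1 M × Any (λ R → M ≡ₘ R [mod + 4 ]) kerReps))
    × ((M : Mat2) → InΓ1 M → ∃ λ (n : Fin 4) → InKer k (inv (S ^ toℕ n) · M))
    × ((n n′ : Fin 4) → InKer k (inv (S ^ toℕ n) · (S ^ toℕ n′)) → n ≡ n′)
mainTheorem4 k k≡±3 =
    (λ M → kernel-mod-4 M ⇔-∘ inKer⇔ M)
  , (λ M detM≡1 →
      map₂ (λ {n} → from (inKer⇔ (inv (S ^ toℕ n) · M))) (coset-representative detM≡1))
  , λ n n′ → S^-cosets-distinct n n′ ∘ proj₂ ∘ to (inKer⇔ (inv (S ^ toℕ n) · (S ^ toℕ n′)))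
  where
  inKer⇔ : ∀ M → InKer k M ⇔ (InΓ1 M × + 4 ∣ f M)
  inKer⇔ = InKer⇔ k k≡±3  -- accepted since k - - + 3 reduces to k + + 3
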